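{- Let $\sigma$ be a word of distinct integers and $T_\sigma=\Psi(\sigma)$. Then $\mathrm{inv}(\sigma)=\mathrm{inv}(T_\sigma)$, $\mathrm{RLmin}(\sigma)=|R_{T_\sigma}|$, and $\mathrm{IDes}(\sigma)=\mathrm{IDes}(T_\sigma)$.
   Context: The map $\Psi$ sends a word $\pi$ of distinct integers to an increasing labeled binary tree: empty word to empty tree; otherwise, with $i$ the least letter and $\pi=\sigma i\tau$, the tree has root $i$, left subtree $\Psi(\sigma)$, right subtree $\Psi(\tau)$. For $\sigma=\sigma_1\cdots\sigma_n$: $\mathrm{inv}(\sigma)$ is the number of pairs $i<j$ with $\sigma_i>\sigma_j$; $\mathrm{RLmin}(\sigma)$ is the number of $\sigma_i$ with $\sigma_j>\sigma_i$ for all $j>i$; $\mathrm{IDes}(\sigma)$ is the set of values $a$ such that the letter $a+1$ (where $a$ and $a+1$ are both letters of $\sigma$; for a permutation of $[n]$ this is $\mathrm{Des}(\sigma^{ -1})$) appears before $a$ in $\sigma$. For an increasing binary tree $T$ (labels increase along paths from the root) with labels $1,\dots,n$: an inversion of $T$ is a pair of vertices $(i,j)$ with $i>j$ such that either $j$ lies to the right of the path from the root to $i$, or $j$ is on the path from the root to $i$ and the left child of $j$ is on this path; $\mathrm{inv}(T)$ is the number of inversions; $i-1$ is an idescent of $T$ if $(i,i-1)$ is an inversion, and $\mathrm{IDes}(T)$ is the set of idescents; $R_T$ is the set of vertices of $T$ not belonging to any left subtree of any vertex (the vertices on the path from the root going always to right children). -}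

module Defs where

open import Data.Bool using (Bool; true; false; if_then_else_; _∧_; _∨_; T)
open import Data.Nat using (ℕ; zero; suc; _+_)
open import Data.Integer using (ℤ; _<_; _<?_; _⊓_; _≟_; 1ℤ) renaming (_+_ to _+ℤ_)
open import Data.List using (List; []; _∷_; _++_; length; filter; foldr; map; cartesianProduct)
open import Data.List.Relation.Unary.All using (All; all?)
open import Data.List.Membership.Propositional using (_∈_)
open import Data.Product using (_×_; _,_; Σ; proj₁; proj₂; ∃)
open import Relation.Nullary.Decidable using (does)
open import Relation.Binary.PropositionalEquality using (_≡_)

invW : List ℤ → ℕ
invW []       = 0
invW (x ∷ xs) = length (filter (λ y → y <? x) xs) + invW xs

RLmin : List ℤ → ℕ
RLmin []       = 0
RLmin (x ∷ xs) = (if does (all? (λ y → x <? y) xs) then 1 else 0) + RLmin xs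

IDesW : List ℤ → ℤ → Set
IDesW σ a = Σ (List ℤ) λ xs → Σ (List ℤ) λ ys →
  (σ ≡ xs ++ ((a +ℤ 1ℤ) ∷ ys)) × (a ∈ ys)

data Tree : Set where
  leaf : Tree
  node : Tree → ℤ → Tree → Tree

splitOn : ℤ → List ℤ → List ℤ × List ℤ
splitOn m []       = [] , []
splitOn m (y ∷ ys) with does (y ≟ m)
... | true  = [] , ys
... | false = (y ∷ proj₁ (splitOn m ys)) , proj₂ (splitOn m ys)

minW : ℤ → List ℤ → ℤ
minW x xs = foldr _⊓_ x xs

-- fuel-driven recursion; fuel = length of the word suffices since both
-- factors σ, τ of π = σ i τ are strictly shorter than π
Ψ-fuel : ℕ → List ℤ → Tree
Ψ-fuel zero    _        = leaf
Ψ-fuel (suc n) []       = leaf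
Ψ-fuel (suc n) (x ∷ xs) =
  let i = minW x xs
      st = splitOn i (x ∷ xs)
  in node (Ψ-fuel n (proj₁ st)) i (Ψ-fuel n (proj₂ st))

Ψ : List ℤ → Tree
Ψ π = Ψ-fuel (length π) π

data Dir : Set where
  L R : Dir

Path : Set
Path = List Dir

data Occ : Tree → Path → ℤ → Set where
  here : ∀ {l x r} → Occ (node l x r) [] x
  inL  : ∀ {l x r p y} → Occ l p y → Occ (node l x r) (L ∷ p) y
  inR  : ∀ {l x r p y} → Occ r p y → Occ (node l x r) (R ∷ p) y

vertices : Tree → List (Path × ℤ)
vertices leaf         = []
vertices (node l x r) =
  ([] , x) ∷ (map (λ { (p , y) → (L ∷ p , y) }) (vertices l)
           ++ map (λ { (p , y) → (R ∷ p , y) }) (vertices r))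

-- rightOf p q : the vertex at address q lies to the right of the path
-- from the root to the vertex at address p (i.e. q is in the right subtree
-- of some vertex v on that path, where the path does not continue into
-- that right subtree)
rightOf : Path → Path → Bool
rightOf []      (R ∷ q) = true
rightOf []      _       = false
rightOf (_ ∷ _) []      = false
rightOf (L ∷ p) (R ∷ q) = true
rightOf (L ∷ p) (L ∷ q) = rightOf p q
rightOf (R ∷ p) (R ∷ q) = rightOf p q
rightOf (R ∷ p) (L ∷ q) = false

-- onPathLeft p q : the vertex at q is on the path from the root to the
-- vertex at p, and the left child of q is on this path
onPathLeft : Path → Path → Bool
onPathLeft []      _       = false
onPathLeft (L ∷ p) []      = true
onPathLeft (R ∷ p) []      = false
onPathLeft (L ∷ p) (L ∷ q) = onPathLeft p q
onPathLeft (R ∷ p) (R ∷ q) = onPathLeft p q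
onPathLeft (L ∷ p) (R ∷ q) = false
onPathLeft (R ∷ p) (L ∷ q) = false

invPos : Path → Path → Bool
invPos p q = rightOf p q ∨ onPathLeft p q

Inversion : Tree → ℤ → ℤ → Set
Inversion T i j = (j < i) × Σ Path λ p → Σ Path λ q →
  Occ T p i × Occ T q j × Data.Bool.T (invPos p q)

isInv : (Path × ℤ) × (Path × ℤ) → Bool
isInv ((p , i) , (q , j)) = does (j <? i) ∧ invPos p q

invT : Tree → ℕ
invT T = length (filter (λ v → Data.Bool._≟_ (isInv v) true)
                        (cartesianProduct (vertices T) (vertices T)))

IDesT : Tree → ℤ → Set
IDesT T a = Inversion T (a +ℤ 1ℤ) a

-- R_T: vertices not in any left subtree = addresses consisting only of R's
isR : Dir → Bool
isR L = false
isR R = true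

allR : Path → Bool
allR []      = true
allR (d ∷ p) = isR d ∧ allR p

RT-size : Tree → ℕ
RT-size T = length (filter (λ v → Data.Bool._≟_ (allR (proj₁ v)) true) (vertices T))

-- Ψ σ is an increasing tree whose in-order reading is σ.  The positional part of a
-- tree inversion (i , j), "j lies to the right of the path to i, or on it with its left
-- child on the path", says exactly that j comes after i in the in-order reading.  So,
-- for every binary tree, the inversions and inverse descents of the tree are those of
-- its in-order reading.  In an increasing tree the root is the least letter and its
-- left subtree is read before it, so the right-to-left minima of the reading are the
-- vertices on the rightmost path.
module Submission where

open import Defs
open import Data.Bool as Bool using (Bool; true; false; if_then_else_; _∧_; T)
open import Data.Bool.Properties using (∧-identityʳ; ∧-zeroʳ)
open import Data.Integer using (ℤ; _<_; _≤_; _<?_; _⊓_; _≟_; 1ℤ) renaming (_+_ to _+ℤ_)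
import Data.Integer.Properties as ℤ
open import Data.List using (List; []; _∷_; _++_; length; filter; map; cartesianProduct)
open import Data.List.Properties
  using (map-++; map-∘; map-cong; length-++-sucʳ; length-++-≤ˡ; length-++-≤ʳ; foldr-preservesᵇ)
open import Data.List.Membership.Propositional using (_∈_)
open import Data.List.Membership.Propositional.Properties using (∈-++⁺ˡ; ∈-++⁺ʳ; ∈-++⁻)
open import Data.List.Relation.Unary.All as All using (All; []; _∷_; all?)
open import Data.List.Relation.Unary.All.Properties using (++⁻ˡ; ++⁻ʳ)
open import Data.List.Relation.Unary.AllPairs using ([]; _∷_)
open import Data.List.Relation.Unary.Any using (here; there)
import Data.List.Relation.Unary.Any as Any
open import Data.List.Relation.Unary.Unique.Propositional using (Unique)
open import Data.Nat as ℕ using (ℕ; zero; suc; _+_)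
import Data.Nat.Properties as ℕ
open import Data.Nat.ListAction using (sum)
open import Data.Nat.ListAction.Properties using (sum-++)
open import Data.Nat.Tactic.RingSolver using (solve-∀)
open import Algebra.Properties.CommutativeSemigroup ℕ.+-commutativeSemigroup
  using (x∙yz≈y∙xz; interchange)
open import Data.Product as Product using (_×_; _,_; Σ; proj₁; proj₂; uncurry)
open import Data.Sum as Sum using (_⊎_; inj₁; inj₂; [_,_]′)
open import Data.Unit using (tt)
open import Function.Bundles using (_⇔_; mk⇔)
import Function.Properties.Equivalence as ⇔
open import Relation.Binary.PropositionalEquality
open import Relation.Nullary using (¬_; yes; no)
open import Relation.Nullary.Decidable using (does; dec-true; dec-false)
open import Relation.Unary using (Pred; Decidable)

private
  variable
    A B : Set
    i j : ℤ

inorder : Tree → List ℤ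
inorder leaf         = []
inorder (node l x r) = inorder l ++ x ∷ inorder r

data Increasing : Tree → Set where
  leaf : Increasing leaf
  node : ∀ {l x r} → All (x <_) (inorder l) → All (x <_) (inorder r) →
         Increasing l → Increasing r → Increasing (node l x r)

rightSpine : Tree → ℕ
rightSpine leaf         = 0
rightSpine (node _ _ r) = suc (rightSpine r)

𝟙 : Bool → ℕ
𝟙 true  = 1
𝟙 false = 0

∑ : List A → (A → ℕ) → ℕ
∑ xs f = sum (map f xs)

infix 2 ∑
syntax ∑ xs (λ x → e) = ∑[ x ∈ xs ] e

∑-++ : ∀ xs ys (f : A → ℕ) → ∑ (xs ++ ys) f ≡ ∑ xs f + ∑ ys f
∑-++ xs ys f = trans (cong sum (map-++ f xs ys)) (sum-++ (map f xs) (map f ys))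

∑-map : (g : B → A) (xs : List B) (f : A → ℕ) → ∑ (map g xs) f ≡ (∑[ x ∈ xs ] f (g x))
∑-map g xs f = cong sum (sym (map-∘ xs))

∑-cong : ∀ xs {f g : A → ℕ} → (∀ x → f x ≡ g x) → ∑ xs f ≡ ∑ xs g
∑-cong xs f≗g = cong sum (map-cong f≗g xs)

∑-zero : ∀ xs {f : A → ℕ} → (∀ x → f x ≡ 0) → ∑ xs f ≡ 0
∑-zero []       f≗0 = refl
∑-zero (x ∷ xs) f≗0 = cong₂ _+_ (f≗0 x) (∑-zero xs f≗0)

∑-+ : ∀ xs (f g : A → ℕ) → (∑[ x ∈ xs ] (f x + g x)) ≡ ∑ xs f + ∑ xs g
∑-+ []       f g = refl
∑-+ (x ∷ xs) f g = trans (cong (f x + g x +_) (∑-+ xs f g)) (interchange (f x) (g x) _ _)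

∑-cartesianProduct : (xs : List A) (ys : List B) (f : A × B → ℕ) →
                     ∑ (cartesianProduct xs ys) f ≡ (∑[ x ∈ xs ] ∑[ y ∈ ys ] f (x , y))
∑-cartesianProduct []       ys f = refl
∑-cartesianProduct (x ∷ xs) ys f = begin
    ∑ (map (x ,_) ys ++ cartesianProduct xs ys) f
  ≡⟨ ∑-++ (map (x ,_) ys) _ f ⟩
    ∑ (map (x ,_) ys) f + ∑ (cartesianProduct xs ys) f
  ≡⟨ cong₂ _+_ (∑-map (x ,_) ys f) (∑-cartesianProduct xs ys f) ⟩
    (∑[ y ∈ ys ] f (x , y)) + (∑[ x′ ∈ xs ] ∑[ y ∈ ys ] f (x′ , y)) ∎
  where open ≡-Reasoning

length-filter : ∀ {p} {P : Pred A p} (P? : Decidable P) xs →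
                length (filter P? xs) ≡ (∑[ x ∈ xs ] 𝟙 (does (P? x)))
length-filter P? []       = refl
length-filter P? (x ∷ xs) with does (P? x)
... | true  = cong suc (length-filter P? xs)
... | false = length-filter P? xs

length-filterᵇ : (f : A → Bool) (xs : List A) →
                 length (filter (λ x → f x Bool.≟ true) xs) ≡ (∑[ x ∈ xs ] 𝟙 (f x))
length-filterᵇ f xs = trans (length-filter _ xs) (∑-cong xs (λ x → cong 𝟙 (does-≟-true (f x))))
  where
  does-≟-true : ∀ b → does (b Bool.≟ true) ≡ b
  does-≟-true true  = refl
  does-≟-true false = refl

-- Inversions

below : ℤ → List ℤ → ℕ
below x ys = ∑[ y ∈ ys ] 𝟙 (does (y <? x))

crossInv : List ℤ → List ℤ → ℕ
crossInv xs ys = ∑[ x ∈ xs ] below x ys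

invW-∷ : ∀ x xs → invW (x ∷ xs) ≡ below x xs + invW xs
invW-∷ x xs = cong (_+ invW xs) (length-filter (_<? x) xs)

invW-++ : ∀ xs ys → invW (xs ++ ys) ≡ invW xs + invW ys + crossInv xs ys
invW-++ []       ys = sym (ℕ.+-identityʳ (invW ys))
invW-++ (x ∷ xs) ys = begin
    invW (x ∷ xs ++ ys)
  ≡⟨ invW-∷ x (xs ++ ys) ⟩
    below x (xs ++ ys) + invW (xs ++ ys)
  ≡⟨ cong₂ _+_ (∑-++ xs ys _) (invW-++ xs ys) ⟩
    below x xs + below x ys + (invW xs + invW ys + crossInv xs ys)
  ≡⟨ rearrange (below x xs) (below x ys) (invW xs) (invW ys) (crossInv xs ys) ⟩
    below x xs + invW xs + invW ys + (below x ys + crossInv xs ys)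
  ≡⟨ cong (λ n → n + invW ys + crossInv (x ∷ xs) ys) (sym (invW-∷ x xs)) ⟩
    invW (x ∷ xs) + invW ys + crossInv (x ∷ xs) ys ∎
  where
  open ≡-Reasoning
  rearrange : ∀ a b c d e → a + b + (c + d + e) ≡ a + c + d + (b + e)
  rearrange = solve-∀

_◃_ : Dir → Path × ℤ → Path × ℤ
d ◃ v = d ∷ proj₁ v , proj₂ v

inversionsFrom : List (Path × ℤ) → Path × ℤ → ℕ
inversionsFrom vs u = ∑[ v ∈ vs ] 𝟙 (isInv (u , v))

invPairs : List (Path × ℤ) → ℕ
invPairs vs = ∑[ u ∈ vs ] inversionsFrom vs u

invT≡invPairs : ∀ t → invT t ≡ invPairs (vertices t)
invT≡invPairs t =
  trans (length-filterᵇ isInv (cartesianProduct (vertices t) (vertices t)))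
        (∑-cartesianProduct (vertices t) (vertices t) (λ uv → 𝟙 (isInv uv)))

∑-vertices-node : ∀ l m r (f : Path × ℤ → ℕ) →
  ∑ (vertices (node l m r)) f ≡
  f ([] , m) + ((∑[ v ∈ vertices l ] f (L ◃ v)) + (∑[ v ∈ vertices r ] f (R ◃ v)))
∑-vertices-node l m r f = cong (f ([] , m) +_)
  (trans (∑-++ (map (L ◃_) (vertices l)) (map (R ◃_) (vertices r)) f)
         (cong₂ _+_ (∑-map (L ◃_) (vertices l) f) (∑-map (R ◃_) (vertices r) f)))

∑-vertices : ∀ t (f : ℤ → ℕ) → (∑[ v ∈ vertices t ] f (proj₂ v)) ≡ ∑ (inorder t) f
∑-vertices leaf         f = refl
∑-vertices (node l m r) f = begin
    (∑[ v ∈ vertices (node l m r) ] f (proj₂ v))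
  ≡⟨ ∑-vertices-node l m r _ ⟩
    f m + ((∑[ v ∈ vertices l ] f (proj₂ v)) + (∑[ v ∈ vertices r ] f (proj₂ v)))
  ≡⟨ cong (f m +_) (cong₂ _+_ (∑-vertices l f) (∑-vertices r f)) ⟩
    f m + (∑ (inorder l) f + ∑ (inorder r) f)
  ≡⟨ x∙yz≈y∙xz (f m) (∑ (inorder l) f) (∑ (inorder r) f) ⟩
    ∑ (inorder l) f + (f m + ∑ (inorder r) f)
  ≡⟨ sym (∑-++ (inorder l) (m ∷ inorder r) f) ⟩
    ∑ (inorder (node l m r)) f ∎
  where open ≡-Reasoning

below-vertices : ∀ t x → (∑[ v ∈ vertices t ] 𝟙 (does (proj₂ v <? x) ∧ true)) ≡ below x (inorder t)
below-vertices t x =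
  trans (∑-cong (vertices t) (λ v → cong 𝟙 (∧-identityʳ _))) (∑-vertices t (λ y → 𝟙 (does (y <? x))))

module _ (l : Tree) (m : ℤ) (r : Tree) where

  private
    vs : List (Path × ℤ)
    vs = vertices (node l m r)

  inversionsFrom-root : inversionsFrom vs ([] , m) ≡ below m (inorder r)
  inversionsFrom-root = begin
      inversionsFrom vs ([] , m)
    ≡⟨ ∑-vertices-node l m r _ ⟩
      𝟙 (does (m <? m) ∧ false)
        + ((∑[ v ∈ vertices l ] 𝟙 (does (proj₂ v <? m) ∧ false))
           + (∑[ v ∈ vertices r ] 𝟙 (does (proj₂ v <? m) ∧ true)))
    ≡⟨ cong₂ _+_ (cong 𝟙 (∧-zeroʳ (does (m <? m))))
                 (cong₂ _+_ (∑-zero (vertices l) (λ v → cong 𝟙 (∧-zeroʳ (does (proj₂ v <? m)))))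
                            (below-vertices r m)) ⟩
      below m (inorder r) ∎
    where open ≡-Reasoning

  inversionsFrom-left : ∀ u →
    inversionsFrom vs (L ◃ u) ≡ inversionsFrom (vertices l) u + below (proj₂ u) (m ∷ inorder r)
  inversionsFrom-left u = begin
      inversionsFrom vs (L ◃ u)
    ≡⟨ ∑-vertices-node l m r _ ⟩
      𝟙 (does (m <? x) ∧ true)
        + (inversionsFrom (vertices l) u + (∑[ v ∈ vertices r ] 𝟙 (does (proj₂ v <? x) ∧ true)))
    ≡⟨ cong₂ (λ a b → a + (inversionsFrom (vertices l) u + b))
             (cong 𝟙 (∧-identityʳ (does (m <? x)))) (below-vertices r x) ⟩
      𝟙 (does (m <? x)) + (inversionsFrom (vertices l) u + below x (inorder r))
    ≡⟨ x∙yz≈y∙xz (𝟙 (does (m <? x))) (inversionsFrom (vertices l) u) (below x (inorder r)) ⟩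
      inversionsFrom (vertices l) u + below x (m ∷ inorder r) ∎
    where
    open ≡-Reasoning
    x : ℤ
    x = proj₂ u

  inversionsFrom-right : ∀ u → inversionsFrom vs (R ◃ u) ≡ inversionsFrom (vertices r) u
  inversionsFrom-right u =
    trans (∑-vertices-node l m r _)
          (cong₂ _+_ (cong 𝟙 (∧-zeroʳ (does (m <? proj₂ u))))
                     (cong (_+ inversionsFrom (vertices r) u)
                           (∑-zero (vertices l) (λ v → cong 𝟙 (∧-zeroʳ (does (proj₂ v <? proj₂ u)))))))

  invPairs-node : invPairs vs ≡
    invPairs (vertices l) + (below m (inorder r) + invPairs (vertices r))
      + crossInv (inorder l) (m ∷ inorder r)
  invPairs-node = begin
      invPairs vs
    ≡⟨ ∑-vertices-node l m r _ ⟩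
      inversionsFrom vs ([] , m)
        + ((∑[ u ∈ vertices l ] inversionsFrom vs (L ◃ u))
           + (∑[ u ∈ vertices r ] inversionsFrom vs (R ◃ u)))
    ≡⟨ cong₂ _+_ inversionsFrom-root
         (cong₂ _+_ (∑-cong (vertices l) inversionsFrom-left) (∑-cong (vertices r) inversionsFrom-right)) ⟩
      root + ((∑[ u ∈ vertices l ] (inversionsFrom (vertices l) u + below (proj₂ u) (m ∷ inorder r))) + right)
    ≡⟨ cong (λ n → root + (n + right))
         (trans (∑-+ (vertices l) _ _) (cong (left +_) (∑-vertices l (λ x → below x (m ∷ inorder r))))) ⟩
      root + ((left + cross) + right)
    ≡⟨ rearrange root left cross right ⟩
      left + (root + right) + cross ∎
    where
    open ≡-Reasoning
    root left right cross : ℕ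
    root  = below m (inorder r)
    left  = invPairs (vertices l)
    right = invPairs (vertices r)
    cross = crossInv (inorder l) (m ∷ inorder r)
    rearrange : ∀ a b c d → a + ((b + c) + d) ≡ b + (a + d) + c
    rearrange = solve-∀

invPairs-inorder : ∀ t → invPairs (vertices t) ≡ invW (inorder t)
invPairs-inorder leaf         = refl
invPairs-inorder (node l m r) = begin
    invPairs (vertices (node l m r))
  ≡⟨ invPairs-node l m r ⟩
    invPairs (vertices l) + (below m (inorder r) + invPairs (vertices r)) + cross
  ≡⟨ cong₂ (λ a b → a + (below m (inorder r) + b) + cross) (invPairs-inorder l) (invPairs-inorder r) ⟩
    invW (inorder l) + (below m (inorder r) + invW (inorder r)) + cross
  ≡⟨ cong (λ n → invW (inorder l) + n + cross) (sym (invW-∷ m (inorder r))) ⟩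
    invW (inorder l) + invW (m ∷ inorder r) + cross
  ≡⟨ sym (invW-++ (inorder l) (m ∷ inorder r)) ⟩
    invW (inorder (node l m r)) ∎
  where
  open ≡-Reasoning
  cross : ℕ
  cross = crossInv (inorder l) (m ∷ inorder r)

invW-inorder : ∀ t → invW (inorder t) ≡ invT t
invW-inorder t = sym (trans (invT≡invPairs t) (invPairs-inorder t))

-- Right-to-left minima

rightSpine-vertices : ∀ t → (∑[ v ∈ vertices t ] 𝟙 (allR (proj₁ v))) ≡ rightSpine t
rightSpine-vertices leaf         = refl
rightSpine-vertices (node l m r) =
  trans (∑-vertices-node l m r (λ v → 𝟙 (allR (proj₁ v))))
        (cong suc (cong₂ _+_ (∑-zero (vertices l) (λ _ → refl)) (rightSpine-vertices r)))

RT-size≡rightSpine : ∀ t → RT-size t ≡ rightSpine t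
RT-size≡rightSpine t =
  trans (length-filterᵇ (λ v → allR (proj₁ v)) (vertices t)) (rightSpine-vertices t)

RLmin-++-∷ : ∀ {m} xs ys → All (m <_) xs → RLmin (xs ++ m ∷ ys) ≡ RLmin (m ∷ ys)
RLmin-++-∷         []       ys []            = refl
RLmin-++-∷ {m = m} (x ∷ xs) ys (m<x ∷ m<xs) =
  trans (cong (λ b → (if b then 1 else 0) + RLmin (xs ++ m ∷ ys))
              (dec-false (all? (x <?_) (xs ++ m ∷ ys)) x-not-minimum))
        (RLmin-++-∷ xs ys m<xs)
  where
  x-not-minimum : ¬ All (x <_) (xs ++ m ∷ ys)
  x-not-minimum x<all = ℤ.<-asym m<x (All.head (++⁻ʳ xs x<all))

RLmin-least : ∀ m ys → All (m <_) ys → RLmin (m ∷ ys) ≡ suc (RLmin ys)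
RLmin-least m ys m<ys = cong (λ b → (if b then 1 else 0) + RLmin ys) (dec-true (all? (m <?_) ys) m<ys)

RLmin-inorder : ∀ {t} → Increasing t → RLmin (inorder t) ≡ rightSpine t
RLmin-inorder leaf = refl
RLmin-inorder {node l m r} (node m<l m<r _ inc-r) = begin
    RLmin (inorder l ++ m ∷ inorder r)
  ≡⟨ RLmin-++-∷ (inorder l) (inorder r) m<l ⟩
    RLmin (m ∷ inorder r)
  ≡⟨ RLmin-least m (inorder r) m<r ⟩
    suc (RLmin (inorder r))
  ≡⟨ cong suc (RLmin-inorder inc-r) ⟩
    suc (rightSpine r) ∎
  where open ≡-Reasoning

-- Inverse descents

data Precedes (i j : ℤ) : List ℤ → Set where
  start : ∀ {ys}   → j ∈ ys → Precedes i j (i ∷ ys)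
  skip  : ∀ {x ys} → Precedes i j ys → Precedes i j (x ∷ ys)

IDesW⇔Precedes : ∀ σ a → IDesW σ a ⇔ Precedes (a +ℤ 1ℤ) a σ
IDesW⇔Precedes σ a = mk⇔ to from
  where
  to : ∀ {σ} → IDesW σ a → Precedes (a +ℤ 1ℤ) a σ
  to ([]     , ys , refl , a∈ys) = start a∈ys
  to (x ∷ xs , ys , refl , a∈ys) = skip (to (xs , ys , refl , a∈ys))
  from : ∀ {σ} → Precedes (a +ℤ 1ℤ) a σ → IDesW σ a
  from (start {ys} a∈ys) = [] , ys , refl , a∈ys
  from (skip {x} p)      = let xs , ys , eq , a∈ys = from p in x ∷ xs , ys , cong (x ∷_) eq , a∈ys

precedes-++⁻ : ∀ xs {ys} → Precedes i j (xs ++ ys) →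
               Precedes i j xs ⊎ (i ∈ xs × j ∈ ys) ⊎ Precedes i j ys
precedes-++⁻ []       p          = inj₂ (inj₂ p)
precedes-++⁻ (x ∷ xs) (start j∈) = Sum.map start (λ j∈ys → inj₁ (here refl , j∈ys)) (∈-++⁻ xs j∈)
precedes-++⁻ (x ∷ xs) (skip p)   = Sum.map skip (Sum.map₁ (Product.map₁ there)) (precedes-++⁻ xs p)

precedes-++⁺ˡ : ∀ {xs} ys → Precedes i j xs → Precedes i j (xs ++ ys)
precedes-++⁺ˡ ys (start j∈) = start (∈-++⁺ˡ j∈)
precedes-++⁺ˡ ys (skip p)   = skip (precedes-++⁺ˡ ys p)

precedes-++⁺ʳ : ∀ xs {ys} → Precedes i j ys → Precedes i j (xs ++ ys)
precedes-++⁺ʳ []       p = p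
precedes-++⁺ʳ (x ∷ xs) p = skip (precedes-++⁺ʳ xs p)

precedes-++⁺ : ∀ {xs} ys → i ∈ xs → j ∈ ys → Precedes i j (xs ++ ys)
precedes-++⁺ {xs = _ ∷ xs} ys (here refl) j∈ = start (∈-++⁺ʳ xs j∈)
precedes-++⁺               ys (there i∈)  j∈ = skip (precedes-++⁺ ys i∈ j∈)

Occ⇒∈ : ∀ {t p x} → Occ t p x → x ∈ inorder t
Occ⇒∈ {node l _ _} here    = ∈-++⁺ʳ (inorder l) (here refl)
Occ⇒∈              (inL o) = ∈-++⁺ˡ (Occ⇒∈ o)
Occ⇒∈ {node l _ _} (inR o) = ∈-++⁺ʳ (inorder l) (there (Occ⇒∈ o))

∈⇒Occ : ∀ t {x} → x ∈ inorder t → Σ Path λ p → Occ t p x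
∈⇒Occ (node l y r) x∈ with ∈-++⁻ (inorder l) x∈
... | inj₁ x∈l         = let p , o = ∈⇒Occ l x∈l in L ∷ p , inL o
... | inj₂ (here refl) = [] , here
... | inj₂ (there x∈r) = let p , o = ∈⇒Occ r x∈r in R ∷ p , inR o

InversionPositions : Tree → ℤ → ℤ → Set
InversionPositions t i j = Σ Path λ p → Σ Path λ q → Occ t p i × Occ t q j × T (invPos p q)

positions⇒precedes : ∀ t → InversionPositions t i j → Precedes i j (inorder t)
positions⇒precedes (node l m r) ([] , R ∷ q , here , inR o , _) =
  precedes-++⁺ʳ (inorder l) (start (Occ⇒∈ o))
positions⇒precedes (node l m r) (L ∷ p , [] , inL o , here , _) =
  precedes-++⁺ (m ∷ inorder r) (Occ⇒∈ o) (here refl)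
positions⇒precedes (node l m r) (L ∷ p , L ∷ q , inL o , inL o′ , pos) =
  precedes-++⁺ˡ (m ∷ inorder r) (positions⇒precedes l (p , q , o , o′ , pos))
positions⇒precedes (node l m r) (L ∷ p , R ∷ q , inL o , inR o′ , _) =
  precedes-++⁺ (m ∷ inorder r) (Occ⇒∈ o) (there (Occ⇒∈ o′))
positions⇒precedes (node l m r) (R ∷ p , R ∷ q , inR o , inR o′ , pos) =
  precedes-++⁺ʳ (inorder l) (skip (positions⇒precedes r (p , q , o , o′ , pos)))

precedes⇒positions : ∀ t → Precedes i j (inorder t) → InversionPositions t i j
precedes⇒positions (node l m r) pr with precedes-++⁻ (inorder l) pr
... | inj₁ pr-l =
  let p , q , o , o′ , pos = precedes⇒positions l pr-l in L ∷ p , L ∷ q , inL o , inL o′ , pos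
... | inj₂ (inj₁ (i∈l , here refl)) =
  let p , o = ∈⇒Occ l i∈l in L ∷ p , [] , inL o , here , tt
... | inj₂ (inj₁ (i∈l , there j∈r)) =
  let p , o = ∈⇒Occ l i∈l ; q , o′ = ∈⇒Occ r j∈r in L ∷ p , R ∷ q , inL o , inR o′ , tt
... | inj₂ (inj₂ (start j∈r)) =
  let q , o = ∈⇒Occ r j∈r in [] , R ∷ q , here , inR o , tt
... | inj₂ (inj₂ (skip pr-r)) =
  let p , q , o , o′ , pos = precedes⇒positions r pr-r in R ∷ p , R ∷ q , inR o , inR o′ , pos

i<i+1 : ∀ i → i < i +ℤ 1ℤ
i<i+1 i = subst (i <_) (ℤ.+-comm 1ℤ i) (ℤ.suc[i]≤j⇒i<j ℤ.≤-refl)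

IDesT⇔Precedes : ∀ t a → IDesT t a ⇔ Precedes (a +ℤ 1ℤ) a (inorder t)
IDesT⇔Precedes t a = mk⇔ (λ inv → positions⇒precedes t (proj₂ inv))
                         (λ pr → i<i+1 a , precedes⇒positions t pr)

IDesW-inorder : ∀ t a → IDesW (inorder t) a ⇔ IDesT t a
IDesW-inorder t a = ⇔.trans (IDesW⇔Precedes (inorder t) a) (⇔.sym (IDesT⇔Precedes t a))

-- The map Ψ

splitOn-∈ : ∀ m σ → m ∈ σ → σ ≡ proj₁ (splitOn m σ) ++ m ∷ proj₂ (splitOn m σ)
splitOn-∈ m (y ∷ ys) m∈ with y ≟ m
... | yes refl = refl
... | no  y≢m  = cong (y ∷_) (splitOn-∈ m ys (Any.tail (≢-sym y≢m) m∈))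

minW-∈ : ∀ x xs → minW x xs ∈ x ∷ xs
minW-∈ x xs = foldr-preservesᵇ {P = _∈ x ∷ xs} ⊓-closed (here refl) (All.tabulate there)
  where
  ⊓-closed : ∀ {y z} → y ∈ x ∷ xs → z ∈ x ∷ xs → y ⊓ z ∈ x ∷ xs
  ⊓-closed {y} {z} y∈ z∈ = [ (λ e → subst (_∈ x ∷ xs) (sym e) y∈)
                           , (λ e → subst (_∈ x ∷ xs) (sym e) z∈) ]′ (ℤ.⊓-sel y z)

minW-≤ : ∀ x xs → All (minW x xs ≤_) (x ∷ xs)
minW-≤ x []       = ℤ.≤-refl ∷ []
minW-≤ x (y ∷ ys) with minW-≤ x ys
... | x≥ ∷ ys≥ = ℤ.i≤j⇒k⊓i≤j y x≥ ∷ ℤ.i⊓j≤i y _ ∷ All.map (ℤ.i≤j⇒k⊓i≤j y) ys≥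

unique-++-∷⁻ : ∀ xs {m : ℤ} {ys} → Unique (xs ++ m ∷ ys) →
               (Unique xs × All (m ≢_) xs) × (Unique ys × All (m ≢_) ys)
unique-++-∷⁻ []       (m∉ys ∷ u) = ([] , []) , (u , m∉ys)
unique-++-∷⁻ (x ∷ xs) (x∉ ∷ u)   =
  let (u-xs , m∉xs) , rest = unique-++-∷⁻ xs u
  in ((++⁻ˡ xs x∉ ∷ u-xs) , (≢-sym (All.head (++⁻ʳ xs x∉)) ∷ m∉xs)) , rest

fuel-split : ∀ {n} xs {m : ℤ} ys → length (xs ++ m ∷ ys) ℕ.≤ suc n →
             length xs ℕ.≤ n × length ys ℕ.≤ n
fuel-split {n} xs {m} ys le = ℕ.≤-trans (length-++-≤ˡ xs) le′ , ℕ.≤-trans (length-++-≤ʳ ys {xs}) le′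
  where
  le′ : length (xs ++ ys) ℕ.≤ n
  le′ = ℕ.≤-pred (subst (ℕ._≤ suc n) (length-++-sucʳ xs m ys) le)

module LeastLetterSplit (x : ℤ) (xs : List ℤ) where

  m : ℤ
  m = minW x xs

  s₁ s₂ : List ℤ
  s₁ = proj₁ (splitOn m (x ∷ xs))
  s₂ = proj₂ (splitOn m (x ∷ xs))

  split : x ∷ xs ≡ s₁ ++ m ∷ s₂
  split = splitOn-∈ m (x ∷ xs) (minW-∈ x xs)

  m≤ : All (m ≤_) (s₁ ++ m ∷ s₂)
  m≤ = subst (All (m ≤_)) split (minW-≤ x xs)

  shorter : ∀ {n} → length (x ∷ xs) ℕ.≤ suc n → length s₁ ℕ.≤ n × length s₂ ℕ.≤ n
  shorter {n} le = fuel-split s₁ s₂ (subst (λ w → length w ℕ.≤ suc n) split le)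

Ψ-fuel-inorder : ∀ n σ → length σ ℕ.≤ n → inorder (Ψ-fuel n σ) ≡ σ
Ψ-fuel-inorder zero    []       _  = refl
Ψ-fuel-inorder (suc n) []       _  = refl
Ψ-fuel-inorder (suc n) (x ∷ xs) le = begin
    inorder (Ψ-fuel n s₁) ++ m ∷ inorder (Ψ-fuel n s₂)
  ≡⟨ cong₂ (λ u v → u ++ m ∷ v) (Ψ-fuel-inorder n s₁ (proj₁ (shorter le)))
                                 (Ψ-fuel-inorder n s₂ (proj₂ (shorter le))) ⟩
    s₁ ++ m ∷ s₂
  ≡⟨ sym split ⟩
    x ∷ xs ∎
  where
  open ≡-Reasoning
  open LeastLetterSplit x xs

Ψ-fuel-increasing : ∀ n σ → length σ ℕ.≤ n → Unique σ → Increasing (Ψ-fuel n σ)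
Ψ-fuel-increasing zero    []       _  _ = leaf
Ψ-fuel-increasing (suc n) []       _  _ = leaf
Ψ-fuel-increasing (suc n) (x ∷ xs) le u =
  let le₁ , le₂                 = shorter le
      (u₁ , m∉s₁) , (u₂ , m∉s₂) = unique-++-∷⁻ s₁ (subst Unique split u)
  in node (above s₁ le₁ (++⁻ˡ s₁ m≤) m∉s₁) (above s₂ le₂ (All.tail (++⁻ʳ s₁ m≤)) m∉s₂)
          (Ψ-fuel-increasing n s₁ le₁ u₁) (Ψ-fuel-increasing n s₂ le₂ u₂)
  where
  open LeastLetterSplit x xs
  above : ∀ s → length s ℕ.≤ n → All (m ≤_) s → All (m ≢_) s → All (m <_) (inorder (Ψ-fuel n s))
  above s s-short m≤s m∉s =
    subst (All (m <_)) (sym (Ψ-fuel-inorder n s s-short)) (All.zipWith (uncurry ℤ.≤∧≢⇒<) (m≤s , m∉s))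

Ψ-inorder : ∀ σ → inorder (Ψ σ) ≡ σ
Ψ-inorder σ = Ψ-fuel-inorder (length σ) σ ℕ.≤-refl

Ψ-increasing : ∀ {σ} → Unique σ → Increasing (Ψ σ)
Ψ-increasing {σ} = Ψ-fuel-increasing (length σ) σ ℕ.≤-refl

proposition4p4 : (σ : List ℤ) → Unique σ →
    (invW σ ≡ invT (Ψ σ)) × (RLmin σ ≡ RT-size (Ψ σ)) ×
    ((a : ℤ) → IDesW σ a ⇔ IDesT (Ψ σ) a)
proposition4p4 σ u =
  subst Statistics (Ψ-inorder σ)
    ( invW-inorder t
    , trans (RLmin-inorder (Ψ-increasing u)) (sym (RT-size≡rightSpine t))
    , IDesW-inorder t )
  where
  t : Tree
  t = Ψ σ
  Statistics : List ℤ → Set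
  Statistics w = (invW w ≡ invT t) × (RLmin w ≡ RT-size t) × ((a : ℤ) → IDesW w a ⇔ IDesT t a)
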